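{- The van der Waerden ideal $\mathcal{W}$ is a $\sigma$-porous subset of $2^\omega$.
   Context: $\omega=\{0,1,2,\dots\}$; subsets of $\omega$ are identified with elements of $2^\omega$ via characteristic functions. For $n\ge1$, $E_n$ is the family of subsets of $\omega$ containing no arithmetic progression $\{a, a+r,\dots,a+(n-1)r\}$ with $a\in\omega$, $r>0$; $\mathcal{W}=\bigcup_n E_n$. $2^\omega$ carries the metric $\rho(s,t)=2^{ -\min\{i: s(i)\neq t(i)\}}$ for $s\ne t$, $\rho(s,s)=0$, with open balls $B(x,r)$. A set $E\subseteq 2^\omega$ is porous if there exist $0<\alpha<1$ and $\varepsilon_0>0$ such that for every $0<\varepsilon\le\varepsilon_0$ and every $x\in 2^\omega$ there is $y$ with $B(y,\alpha\varepsilon)\subseteq B(x,\varepsilon)\setminus E$. A set is $\sigma$-porous if it is a countable union of porous sets.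
   Formalization: The radius ε in the definition of a porous set ranges only over the positive rationals, and the constants α and ε₀ are taken in ℚ. -}

module Defs where

open import Data.Nat using (ℕ; zero; suc; _+_; _*_; _<_)
open import Data.Bool using (Bool; true)
open import Data.Product using (Σ; ∃; _×_)
open import Relation.Nullary using (¬_)
open import Relation.Binary.PropositionalEquality using (_≡_)
open import Data.Rational as ℚ using (ℚ; 0ℚ; 1ℚ; ½)

-- Cantor space 2^ω ; a subset A ⊆ ω is identified with its characteristic function
Cantor : Set
Cantor = ℕ → Bool

2^-_ : ℕ → ℚ
2^- zero    = 1ℚ
2^- (suc i) = ½ ℚ.* (2^- i)

-- Open ball: z ∈ B(x, ε)  iff  ρ(x,z) < ε, where ρ(x,z) = 2^(-min{i : x i ≠ z i}) (0 if x = z).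
-- Unfolded: ρ(x,z) < ε  iff  x and z agree at every index i with 2^(-i) ≥ ε.
Ball : Cantor → ℚ → Cantor → Set
Ball x ε z = ∀ i → ε ℚ.≤ 2^- i → x i ≡ z i

ContainsAP : ℕ → Cantor → Set
ContainsAP n x = Σ ℕ λ a → Σ ℕ λ r → (0 < r) × (∀ j → j < n → x (a + j * r) ≡ true)

E : ℕ → Cantor → Set
E n x = ¬ ContainsAP n x

W : Cantor → Set
W x = Σ ℕ λ n → E (suc n) x

Porous : (Cantor → Set) → Set
Porous S =
  Σ ℚ λ α → Σ ℚ λ ε₀ → (0ℚ ℚ.< α) × (α ℚ.< 1ℚ) × (0ℚ ℚ.< ε₀) ×
    (∀ ε → 0ℚ ℚ.< ε → ε ℚ.≤ ε₀ → ∀ x → Σ Cantor λ y →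
       ∀ z → Ball y (α ℚ.* ε) z → Ball x ε z × ¬ S z)

SigmaPorous : (Cantor → Set) → Set₁
SigmaPorous S = Σ (ℕ → Cantor → Set) λ P → (∀ k → Porous (P k)) ×
  ((∀ x → S x → Σ ℕ λ k → P k x) × (∀ x k → P k x → S x))

{-# OPTIONS --safe #-}
module Submission where

-- Fix n. For 0 < ε ≤ 1 let b be the last index with ε ≤ 2^-b, so that B(x, ε) is the set of
-- sequences agreeing with x up to b. Let y copy x up to b and be constantly true afterwards.
-- A sequence in B(y, 2^-(n+1)·ε) agrees with y up to b + n + 1, hence lies in B(x, ε) and
-- contains the progression b+1, b+2, …, b+n. So E_n is porous with α = 2^-(n+1), and 𝒲 is the
-- countable union of the E_(n+1).

open import Defs
open import Data.Nat as ℕ using (ℕ; zero; suc; _+_; _*_; _<_; z≤n; s≤s; _≤′_; ≤′-refl; ≤′-step)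
import Data.Nat.Properties as ℕ
open import Data.Nat.Tactic.RingSolver using (solve-∀)
import Data.Integer as ℤ
open import Data.Rational as ℚ using (ℚ; mkℚ; 0ℚ; 1ℚ; ½)
import Data.Rational.Properties as ℚ
import Data.Rational.Unnormalised as ℚᵘ
import Data.Rational.Unnormalised.Properties as ℚᵘ
open import Data.Bool using (true; if_then_else_)
open import Data.Product using (Σ; ∃; _×_; _,_)
open import Data.Empty using (⊥-elim)
open import Function using (_∘_)
open import Relation.Nullary using (¬_; yes; no; does)
open import Relation.Nullary.Decidable using (from-yes; dec-true; dec-false)
open import Relation.Unary using (Decidable)
open import Relation.Binary.PropositionalEquality using (_≡_; refl; sym; trans; cong; subst)

private
  variable
    i j n : ℕ
    p q ε : ℚ

  <⇒≱ : p ℚ.< q → ¬ q ℚ.≤ p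
  <⇒≱ p<q q≤p = ℚ.<-irrefl refl (ℚ.<-≤-trans p<q q≤p)

2^-‿positive : ∀ i → 0ℚ ℚ.< 2^- i
2^-‿positive zero    = from-yes (0ℚ ℚ.<? 1ℚ)
2^-‿positive (suc i) =
  ℚ.positive⁻¹ (½ ℚ.* 2^- i) {{ℚ.pos*pos⇒pos ½ (2^- i) {{ℚ.positive (2^-‿positive i)}}}}

2^-‿+ : ∀ i j → 2^- (i + j) ≡ 2^- i ℚ.* 2^- j
2^-‿+ zero    j = sym (ℚ.*-identityˡ (2^- j))
2^-‿+ (suc i) j = trans (cong (½ ℚ.*_) (2^-‿+ i j)) (sym (ℚ.*-assoc ½ (2^- i) (2^- j)))

2^-‿suc≤ : ∀ i → 2^- suc i ℚ.≤ 2^- i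
2^-‿suc≤ i = subst (2^- suc i ℚ.≤_) (ℚ.*-identityˡ (2^- i))
  (ℚ.*-monoʳ-≤-nonNeg (2^- i) {{ℚ.nonNegative (ℚ.<⇒≤ (2^-‿positive i))}} (from-yes (½ ℚ.≤? 1ℚ)))

2^-‿antitone : i ℕ.≤ j → 2^- j ℚ.≤ 2^- i
2^-‿antitone = antitone′ ∘ ℕ.≤⇒≤′
  where
  antitone′ : i ≤′ j → 2^- j ℚ.≤ 2^- i
  antitone′ ≤′-refl                    = ℚ.≤-refl
  antitone′ {j = suc j} (≤′-step i≤′j) = ℚ.≤-trans (2^-‿suc≤ j) (antitone′ i≤′j)

2^-‿suc<1 : ∀ n → 2^- suc n ℚ.< 1ℚ
2^-‿suc<1 n = ℚ.≤-<-trans (2^-‿antitone {1} {suc n} (s≤s z≤n)) (from-yes (2^- 1 ℚ.<? 1ℚ))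

mersenne : ℕ → ℕ
mersenne zero    = zero
mersenne (suc i) = suc (2 * mersenne i)

≤-mersenne : ∀ i → i ℕ.≤ mersenne i
≤-mersenne zero    = z≤n
≤-mersenne (suc i) = s≤s (ℕ.≤-trans (≤-mersenne i) (ℕ.m≤m+n (mersenne i) _))

-- mkℚᵘ p d denotes p / (d + 1), so this says 2^-i = 1 / 2^i.
toℚᵘ-2^- : ∀ i → ℚ.toℚᵘ (2^- i) ℚᵘ.≃ ℚᵘ.mkℚᵘ (ℤ.+ 1) (mersenne i)
toℚᵘ-2^- zero    = ℚᵘ.≃-refl
toℚᵘ-2^- (suc i) = ℚᵘ.≃-trans (ℚ.toℚᵘ-homo-* ½ (2^- i))
  (ℚᵘ.≃-trans (ℚᵘ.*-congˡ {ℚ.toℚᵘ ½} (toℚᵘ-2^- i)) (ℚᵘ.*≡* (cong ℤ.+_ (halving (mersenne i)))))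
  where
  -- ½ · 1/(m+1) = 1/(2m+2), cross-multiplied and in the normal form the ℚᵘ operations reduce to
  halving : ∀ m → suc (suc (m + 1 * m + 0 * suc (suc (m + 1 * m))))
                ≡ suc (m + 1 * suc m + 0 * suc (m + 1 * suc m))
  halving = solve-∀

2^-‿archimedean : ∀ ε → 0ℚ ℚ.< ε → ∃ λ N → 2^- N ℚ.< ε
2^-‿archimedean (mkℚ (ℤ.+ zero)  q _) (ℚ.*<* (ℤ.+<+ ()))
2^-‿archimedean (mkℚ ℤ.-[1+ p ]  q _) (ℚ.*<* ())
2^-‿archimedean (mkℚ ℤ.+[1+ p ]  q _) _ =
  suc q , ℚ.toℚᵘ-cancel-< (ℚᵘ.<-respˡ-≃ (ℚᵘ.≃-sym (toℚᵘ-2^- (suc q))) (ℚᵘ.*<* (ℤ.+<+ q+1<)))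
  where
  q+1< : 1 * suc q < suc p * suc (mersenne (suc q))
  q+1< = ℕ.<-≤-trans (s≤s (subst (ℕ._≤ mersenne (suc q)) (cong suc (sym (ℕ.+-identityʳ q)))
                                 (≤-mersenne (suc q))))
                     (ℕ.m≤n*m (suc (mersenne (suc q))) (suc p))

∃-crossing : {P : ℕ → Set} → Decidable P → P 0 → ¬ P n → ∃ λ b → P b × ¬ P (suc b)
∃-crossing {zero}  P? P0 ¬Pn = ⊥-elim (¬Pn P0)
∃-crossing {suc n} P? P0 ¬Pn with P? n
... | yes Pn = n , Pn , ¬Pn
... | no ¬Pn′ = ∃-crossing P? P0 ¬Pn′

2^-‿scale : 0ℚ ℚ.< ε → ε ℚ.≤ 1ℚ → ∃ λ b → ε ℚ.≤ 2^- b × 2^- suc b ℚ.< ε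
2^-‿scale {ε} 0<ε ε≤1 with 2^-‿archimedean ε 0<ε
... | N , 2^-N<ε with ∃-crossing {N} (λ i → ε ℚ.≤? 2^- i) ε≤1 (<⇒≱ 2^-N<ε)
... | b , ε≤2^-b , ε≰2^-sb = b , ε≤2^-b , ℚ.≰⇒> ε≰2^-sb

padWithTrue : ℕ → Cantor → Cantor
padWithTrue b x i = if does (i ℕ.≤? b) then x i else true

padWithTrue-≤ : ∀ {b} x → i ℕ.≤ b → padWithTrue b x i ≡ x i
padWithTrue-≤ {i} {b} x i≤b rewrite dec-true (i ℕ.≤? b) i≤b = refl

padWithTrue-> : ∀ {b} x → b < i → padWithTrue b x i ≡ true
padWithTrue-> {i} {b} x b<i rewrite dec-false (i ℕ.≤? b) (ℕ.<⇒≱ b<i) = refl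

run⇒ContainsAP : ∀ z a → (∀ j → j < n → z (a + j) ≡ true) → ContainsAP n z
run⇒ContainsAP z a run = a , 1 , s≤s z≤n , λ j j<n →
  subst (λ k → z (a + k) ≡ true) (sym (ℕ.*-identityʳ j)) (run j j<n)

Ball⇒agree : ∀ {x z δ} m → δ ℚ.≤ 2^- m → Ball x δ z → ∀ i → i ℕ.≤ m → x i ≡ z i
Ball⇒agree m δ≤2^-m x∈B i i≤m = x∈B i (ℚ.≤-trans δ≤2^-m (2^-‿antitone i≤m))

E-porous : ∀ n → Porous (E n)
E-porous n = α , 1ℚ , 2^-‿positive (suc n) , 2^-‿suc<1 n , from-yes (0ℚ ℚ.<? 1ℚ) , hole
  where
  α = 2^- suc n
  hole : ∀ ε → 0ℚ ℚ.< ε → ε ℚ.≤ 1ℚ → ∀ x → Σ Cantor λ y →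
           ∀ z → Ball y (α ℚ.* ε) z → Ball x ε z × ¬ E n z
  hole ε 0<ε ε≤1 x with 2^-‿scale 0<ε ε≤1
  ... | b , ε≤2^-b , 2^-sb<ε = y , λ z z∈B → inBall z∈B , λ noAP → noAP (inAP z z∈B)
    where
    y = padWithTrue b x

    αε≤ : α ℚ.* ε ℚ.≤ 2^- (b + suc n)
    αε≤ = begin
      α ℚ.* ε         ≤⟨ ℚ.*-monoˡ-≤-nonNeg α {{ℚ.nonNegative (ℚ.<⇒≤ (2^-‿positive (suc n)))}} ε≤2^-b ⟩
      α ℚ.* 2^- b     ≡⟨ ℚ.*-comm α (2^- b) ⟩
      2^- b ℚ.* α     ≡⟨ sym (2^-‿+ b (suc n)) ⟩
      2^- (b + suc n) ∎
      where open ℚ.≤-Reasoning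

    inBall : ∀ {z} → Ball y (α ℚ.* ε) z → Ball x ε z
    inBall z∈B i ε≤2^-i =
      trans (sym (padWithTrue-≤ x i≤b)) (Ball⇒agree _ αε≤ z∈B i (ℕ.≤-trans i≤b (ℕ.m≤m+n b (suc n))))
      where
      i≤b : i ℕ.≤ b
      i≤b = ℕ.≮⇒≥ λ b<i → <⇒≱ 2^-sb<ε (ℚ.≤-trans ε≤2^-i (2^-‿antitone b<i))

    inAP : ∀ z → Ball y (α ℚ.* ε) z → ContainsAP n z
    inAP z z∈B = run⇒ContainsAP z (suc b) λ j j<n →
      trans (sym (Ball⇒agree _ αε≤ z∈B (suc b + j) (ℕ.+-monoʳ-< b (ℕ.m<n⇒m<1+n j<n))))
            (padWithTrue-> x (s≤s (ℕ.m≤m+n b j)))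

mainTheorem2 : SigmaPorous W
mainTheorem2 = (λ k → E (suc k)) , (λ k → E-porous (suc k)) , (λ x w → w) , (λ x k x∈E → k , x∈E)
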